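{- Let $M$ be a matching of $Q_3$ with $|M|=3$. Then there is at most one edge $e\in E(Q_3)\setminus M$ such that $M\cup\{e\}$ is not contained in any Hamiltonian cycle of $Q_3$.
   Context: $Q_3$ is the 3-dimensional hypercube (binary strings of length 3, adjacent iff they differ in one position). A matching is a set of pairwise vertex-disjoint edges. -}

module Defs where

open import Data.Bool using (Bool; not)
open import Data.Fin using (Fin; zero; suc)
open import Data.Vec using (Vec; _[_]%=_)
open import Data.Product using (Σ; ∃; _×_; _,_)
open import Data.Sum using (_⊎_)
open import Relation.Binary.PropositionalEquality using (_≡_; _≢_)
open import Function.Definitions using (Injective; Surjective)

Vertex : Set
Vertex = Vec Bool 3

Adjacent : Vertex → Vertex → Set
Adjacent u v = Σ (Fin 3) λ i → v ≡ (u [ i ]%= not)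

-- An edge of Q₃: two endpoints which are adjacent (an unordered pair,
-- compared via SameEdge below).
record Edge : Set where
  constructor edge
  field
    end₁ : Vertex
    end₂ : Vertex
    adj  : Adjacent end₁ end₂
open Edge public

SameEdge : Edge → Edge → Set
SameEdge e f = (end₁ e ≡ end₁ f × end₂ e ≡ end₂ f) ⊎ (end₁ e ≡ end₂ f × end₂ e ≡ end₁ f)

Incident : Vertex → Edge → Set
Incident v e = (v ≡ end₁ e) ⊎ (v ≡ end₂ e)

Disjoint : Edge → Edge → Set
Disjoint e f = ∀ v → Incident v e → Incident v f → Data.Empty.⊥
  where import Data.Empty

record Matching3 : Set where
  constructor matching3
  field
    m₁ m₂ m₃ : Edge
    d₁₂ : Disjoint m₁ m₂
    d₁₃ : Disjoint m₁ m₃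
    d₂₃ : Disjoint m₂ m₃
open Matching3 public

InMatching : Edge → Matching3 → Set
InMatching e M = SameEdge e (m₁ M) ⊎ SameEdge e (m₂ M) ⊎ SameEdge e (m₃ M)

next : Fin 8 → Fin 8
next zero = suc zero
next (suc zero) = suc (suc zero)
next (suc (suc zero)) = suc (suc (suc zero))
next (suc (suc (suc zero))) = suc (suc (suc (suc zero)))
next (suc (suc (suc (suc zero)))) = suc (suc (suc (suc (suc zero))))
next (suc (suc (suc (suc (suc zero))))) = suc (suc (suc (suc (suc (suc zero)))))
next (suc (suc (suc (suc (suc (suc zero)))))) = suc (suc (suc (suc (suc (suc (suc zero))))))
next (suc (suc (suc (suc (suc (suc (suc zero))))))) = zero

record HamCycle : Set where
  constructor hamCycle
  field
    pos   : Fin 8 → Vertex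
    inj   : Injective _≡_ _≡_ pos
    surj  : Surjective _≡_ _≡_ pos
    steps : ∀ k → Adjacent (pos k) (pos (next k))
open HamCycle public

EdgeOf : Edge → HamCycle → Set
EdgeOf e C = ∃ λ k →
  (pos C k ≡ end₁ e × pos C (next k) ≡ end₂ e) ⊎
  (pos C k ≡ end₂ e × pos C (next k) ≡ end₁ e)

ContainedWith : Matching3 → Edge → HamCycle → Set
ContainedWith M e C = EdgeOf (m₁ M) C × EdgeOf (m₂ M) C × EdgeOf (m₃ M) C × EdgeOf e C

Extendable : Matching3 → Edge → Set
Extendable M e = ∃ λ C → ContainedWith M e C

module Submission where

-- It suffices to exhibit enough Hamiltonian cycles: Q₃ has six of them (as edge sets), listed
-- in hamCycles, and for every 3-matching M those through M cover all but at most one of the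
-- nine edges outside M.  After numbering the twelve edges this is a finite statement about
-- indices, decided by evaluation.

open import Data.Bool using (Bool; true; false; not)
import Data.Bool.Properties as Bool
open import Data.Fin using (Fin; #_; _≟_)
open import Data.Fin.Properties using (all?; any?)
import Data.Nat as ℕ
open import Data.Product using (∃; _×_; _,_; proj₁; proj₂)
open import Data.Sum using (inj₁; inj₂)
open import Data.Vec using (Vec; []; _∷_; lookup; _[_]%=_)
open import Data.Vec.Properties using (≡-dec)
open import Function using (_∘_)
open import Relation.Binary.Bundles using (Setoid)
open import Relation.Binary.Definitions using (DecidableEquality)
open import Relation.Binary.PropositionalEquality using (_≡_; _≢_; refl; sym; trans; cong)
import Relation.Binary.Reasoning.Setoid as SetoidReasoning
open import Relation.Nullary using (¬_; Dec)
open import Relation.Nullary.Decidable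
  using (True; toWitness; from-yes; map′; ¬?; _×-dec_; _⊎-dec_; _→-dec_)

open import Defs

SameEdge-refl : ∀ {e} → SameEdge e e
SameEdge-refl = inj₁ (refl , refl)

SameEdge-sym : ∀ {e f} → SameEdge e f → SameEdge f e
SameEdge-sym (inj₁ (p , q)) = inj₁ (sym p , sym q)
SameEdge-sym (inj₂ (p , q)) = inj₂ (sym q , sym p)

SameEdge-trans : ∀ {e f g} → SameEdge e f → SameEdge f g → SameEdge e g
SameEdge-trans (inj₁ (p , q)) (inj₁ (r , s)) = inj₁ (trans p r , trans q s)
SameEdge-trans (inj₁ (p , q)) (inj₂ (r , s)) = inj₂ (trans p r , trans q s)
SameEdge-trans (inj₂ (p , q)) (inj₁ (r , s)) = inj₂ (trans p s , trans q r)
SameEdge-trans (inj₂ (p , q)) (inj₂ (r , s)) = inj₁ (trans p s , trans q r)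

SameEdge-setoid : Setoid _ _
SameEdge-setoid = record
  { Carrier       = Edge
  ; _≈_           = SameEdge
  ; isEquivalence = record
    { refl  = λ {e} → SameEdge-refl {e}
    ; sym   = λ {e} {f} → SameEdge-sym {e} {f}
    ; trans = λ {e} {f} {g} → SameEdge-trans {e} {f} {g}
    }
  }

Incident-resp : ∀ {v e f} → SameEdge e f → Incident v e → Incident v f
Incident-resp (inj₁ (p , q)) (inj₁ r) = inj₁ (trans r p)
Incident-resp (inj₁ (p , q)) (inj₂ r) = inj₂ (trans r q)
Incident-resp (inj₂ (p , q)) (inj₁ r) = inj₂ (trans r p)
Incident-resp (inj₂ (p , q)) (inj₂ r) = inj₁ (trans r q)

Disjoint-resp : ∀ {e e′ f f′} → SameEdge e e′ → SameEdge f f′ → Disjoint e f → Disjoint e′ f′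
Disjoint-resp {e} {e′} {f} {f′} e≈e′ f≈f′ e#f v v∈e′ v∈f′ =
  e#f v (Incident-resp {e = e′} {e} (SameEdge-sym {e} {e′} e≈e′) v∈e′)
        (Incident-resp {e = f′} {f} (SameEdge-sym {f} {f′} f≈f′) v∈f′)

EdgeOf-resp : ∀ {e f} C → SameEdge e f → EdgeOf e C → EdgeOf f C
EdgeOf-resp C (inj₁ (p , q)) (k , inj₁ (r , s)) = k , inj₁ (trans r p , trans s q)
EdgeOf-resp C (inj₁ (p , q)) (k , inj₂ (r , s)) = k , inj₂ (trans r q , trans s p)
EdgeOf-resp C (inj₂ (p , q)) (k , inj₁ (r , s)) = k , inj₂ (trans r p , trans s q)
EdgeOf-resp C (inj₂ (p , q)) (k , inj₂ (r , s)) = k , inj₁ (trans r q , trans s p)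

allBoolVec? : ∀ n {P : Vec Bool n → Set} → (∀ v → Dec (P v)) → Dec (∀ v → P v)
allBoolVec? ℕ.zero P? = map′ (λ p → λ { [] → p }) (λ ∀P → ∀P []) (P? [])
allBoolVec? (ℕ.suc n) P? =
  map′ (λ (p₀ , p₁) → λ { (false ∷ v) → p₀ v ; (true ∷ v) → p₁ v })
       (λ ∀P → (λ v → ∀P (false ∷ v)) , (λ v → ∀P (true ∷ v)))
       (allBoolVec? n (λ v → P? (false ∷ v)) ×-dec allBoolVec? n (λ v → P? (true ∷ v)))

_≟ᵥ_ : DecidableEquality Vertex
_≟ᵥ_ = ≡-dec Bool._≟_

adjacent? : ∀ u v → Dec (Adjacent u v)
adjacent? u v = any? λ i → v ≟ᵥ (u [ i ]%= not)

incident? : ∀ v e → Dec (Incident v e)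
incident? v e = v ≟ᵥ end₁ e ⊎-dec v ≟ᵥ end₂ e

sameEdge? : ∀ e f → Dec (SameEdge e f)
sameEdge? e f =
  (end₁ e ≟ᵥ end₁ f ×-dec end₂ e ≟ᵥ end₂ f) ⊎-dec (end₁ e ≟ᵥ end₂ f ×-dec end₂ e ≟ᵥ end₁ f)

disjoint? : ∀ e f → Dec (Disjoint e f)
disjoint? e f = allBoolVec? 3 λ v → incident? v e →-dec ¬? (incident? v f)

edgeOf? : ∀ e C → Dec (EdgeOf e C)
edgeOf? e C = any? λ k →
  (pos C k ≟ᵥ end₁ e ×-dec pos C (next k) ≟ᵥ end₂ e) ⊎-dec
  (pos C k ≟ᵥ end₂ e ×-dec pos C (next k) ≟ᵥ end₁ e)

IsHamiltonian : (Fin 8 → Vertex) → Set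
IsHamiltonian p =
  (∀ k l → p k ≡ p l → k ≡ l) × (∀ v → ∃ λ k → p k ≡ v) × (∀ k → Adjacent (p k) (p (next k)))

isHamiltonian? : ∀ p → Dec (IsHamiltonian p)
isHamiltonian? p =
  all? (λ k → all? λ l → p k ≟ᵥ p l →-dec k ≟ l) ×-dec
  allBoolVec? 3 (λ v → any? λ k → p k ≟ᵥ v) ×-dec
  all? (λ k → adjacent? (p k) (p (next k)))

toHamCycle : ∀ p → IsHamiltonian p → HamCycle
toHamCycle p (injective , surjective , steps) =
  hamCycle p (injective _ _) (λ v → let k , pk≡v = surjective v in k , λ { refl → pk≡v }) steps

cycleThrough : (vs : Vec Vertex 8) → {True (isHamiltonian? (lookup vs))} → HamCycle
cycleThrough vs {h} = toHamCycle (lookup vs) (toWitness h)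

v000 v001 v010 v011 v100 v101 v110 v111 : Vertex
v000 = false ∷ false ∷ false ∷ []
v001 = false ∷ false ∷ true ∷ []
v010 = false ∷ true ∷ false ∷ []
v011 = false ∷ true ∷ true ∷ []
v100 = true ∷ false ∷ false ∷ []
v101 = true ∷ false ∷ true ∷ []
v110 = true ∷ true ∷ false ∷ []
v111 = true ∷ true ∷ true ∷ []

along : Vertex → Fin 3 → Edge
along u i = edge u (u [ i ]%= not) (i , refl)

edgeTable : Vec Edge 12
edgeTable =
  along v000 (# 0) ∷ along v001 (# 0) ∷ along v010 (# 0) ∷ along v011 (# 0) ∷
  along v000 (# 1) ∷ along v001 (# 1) ∷ along v100 (# 1) ∷ along v101 (# 1) ∷
  along v000 (# 2) ∷ along v010 (# 2) ∷ along v100 (# 2) ∷ along v110 (# 2) ∷ []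

edgeAt : Fin 12 → Edge
edgeAt = lookup edgeTable

edgeTable-complete : ∀ u i → ∃ λ x → SameEdge (along u i) (edgeAt x)
edgeTable-complete =
  from-yes (allBoolVec? 3 λ u → all? λ i → any? λ x → sameEdge? (along u i) (edgeAt x))

indexOf : Edge → Fin 12
indexOf (edge u _ (i , refl)) = proj₁ (edgeTable-complete u i)

indexOf-sound : ∀ e → SameEdge e (edgeAt (indexOf e))
indexOf-sound (edge u _ (i , refl)) = proj₂ (edgeTable-complete u i)

indexOf-injective : ∀ e f → indexOf e ≡ indexOf f → SameEdge e f
indexOf-injective e f same-index = begin
  e              ≈⟨ indexOf-sound e ⟩
  edgeAt (indexOf e)  ≡⟨ cong edgeAt same-index ⟩
  edgeAt (indexOf f)  ≈⟨ indexOf-sound f ⟨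
  f              ∎
  where open SetoidReasoning SameEdge-setoid

indexOf-Disjoint : ∀ a b → Disjoint a b → Disjoint (edgeAt (indexOf a)) (edgeAt (indexOf b))
indexOf-Disjoint a b =
  Disjoint-resp {a} {edgeAt (indexOf a)} {b} {edgeAt (indexOf b)}
    (indexOf-sound a) (indexOf-sound b)

indexOf-EdgeOf : ∀ a C → EdgeOf (edgeAt (indexOf a)) C → EdgeOf a C
indexOf-EdgeOf a C =
  EdgeOf-resp {edgeAt (indexOf a)} {a} C (SameEdge-sym {a} {edgeAt (indexOf a)} (indexOf-sound a))

hamCycles : Vec HamCycle 6
hamCycles =
  cycleThrough (v000 ∷ v001 ∷ v011 ∷ v111 ∷ v101 ∷ v100 ∷ v110 ∷ v010 ∷ []) ∷
  cycleThrough (v000 ∷ v001 ∷ v101 ∷ v100 ∷ v110 ∷ v111 ∷ v011 ∷ v010 ∷ []) ∷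
  cycleThrough (v000 ∷ v001 ∷ v011 ∷ v010 ∷ v110 ∷ v111 ∷ v101 ∷ v100 ∷ []) ∷
  cycleThrough (v000 ∷ v001 ∷ v101 ∷ v111 ∷ v011 ∷ v010 ∷ v110 ∷ v100 ∷ []) ∷
  cycleThrough (v000 ∷ v010 ∷ v011 ∷ v001 ∷ v101 ∷ v111 ∷ v110 ∷ v100 ∷ []) ∷
  cycleThrough (v000 ∷ v010 ∷ v110 ∷ v111 ∷ v011 ∷ v001 ∷ v101 ∷ v100 ∷ []) ∷ []

-- Entry k of row t is the index of the edge from vertex k to vertex k + 1 of cycle t.
hamCycleEdges : Vec (Vec (Fin 12) 8) 6
hamCycleEdges =
  (# 8 ∷ # 5 ∷ # 3 ∷ # 7 ∷ # 10 ∷ # 6 ∷ # 2 ∷ # 4 ∷ []) ∷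
  (# 8 ∷ # 1 ∷ # 10 ∷ # 6 ∷ # 11 ∷ # 3 ∷ # 9 ∷ # 4 ∷ []) ∷
  (# 8 ∷ # 5 ∷ # 9 ∷ # 2 ∷ # 11 ∷ # 7 ∷ # 10 ∷ # 0 ∷ []) ∷
  (# 8 ∷ # 1 ∷ # 7 ∷ # 3 ∷ # 9 ∷ # 2 ∷ # 6 ∷ # 0 ∷ []) ∷
  (# 4 ∷ # 9 ∷ # 5 ∷ # 1 ∷ # 7 ∷ # 11 ∷ # 6 ∷ # 0 ∷ []) ∷
  (# 4 ∷ # 2 ∷ # 11 ∷ # 3 ∷ # 5 ∷ # 1 ∷ # 10 ∷ # 0 ∷ []) ∷ []

OnCycle : Fin 12 → Fin 6 → Set
OnCycle x t = ∃ λ k → lookup (lookup hamCycleEdges t) k ≡ x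

onCycle? : ∀ x t → Dec (OnCycle x t)
onCycle? x t = any? λ k → lookup (lookup hamCycleEdges t) k ≟ x

OnCycle-sound : ∀ x t → OnCycle x t → EdgeOf (edgeAt x) (lookup hamCycles t)
OnCycle-sound x t (k , refl) = listed t k
  where
  listed : ∀ t k → EdgeOf (edgeAt (lookup (lookup hamCycleEdges t) k)) (lookup hamCycles t)
  listed = from-yes (all? λ t → all? λ k →
    edgeOf? (edgeAt (lookup (lookup hamCycleEdges t) k)) (lookup hamCycles t))

Blocked : Fin 12 → Fin 12 → Fin 12 → Fin 12 → Set
Blocked i j k x = x ≢ i × x ≢ j × x ≢ k ×
  ¬ (∃ λ t → OnCycle i t × OnCycle j t × OnCycle k t × OnCycle x t)

blocked? : ∀ i j k x → Dec (Blocked i j k x)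
blocked? i j k x = ¬? (x ≟ i) ×-dec ¬? (x ≟ j) ×-dec ¬? (x ≟ k) ×-dec
  ¬? (any? λ t → onCycle? i t ×-dec onCycle? j t ×-dec onCycle? k t ×-dec onCycle? x t)

atMostOneBlocked : ∀ i j → Disjoint (edgeAt i) (edgeAt j) →
  ∀ k → Disjoint (edgeAt i) (edgeAt k) → Disjoint (edgeAt j) (edgeAt k) →
  ∀ x → Blocked i j k x → ∀ y → Blocked i j k y → x ≡ y
atMostOneBlocked = from-yes
  (all? λ i → all? λ j → disjoint? (edgeAt i) (edgeAt j) →-dec
   all? λ k → disjoint? (edgeAt i) (edgeAt k) →-dec disjoint? (edgeAt j) (edgeAt k) →-dec
   all? λ x → blocked? i j k x →-dec all? λ y → blocked? i j k y →-dec x ≟ y)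

nonExtendable⇒Blocked : ∀ M e → ¬ InMatching e M → ¬ Extendable M e →
  Blocked (indexOf (m₁ M)) (indexOf (m₂ M)) (indexOf (m₃ M)) (indexOf e)
nonExtendable⇒Blocked M e e∉M e-stuck =
  e∉M ∘ inj₁ ∘ indexOf-injective e (m₁ M) ,
  e∉M ∘ inj₂ ∘ inj₁ ∘ indexOf-injective e (m₂ M) ,
  e∉M ∘ inj₂ ∘ inj₂ ∘ indexOf-injective e (m₃ M) ,
  λ (t , a∈t , b∈t , c∈t , e∈t) → e-stuck (lookup hamCycles t ,
    onCycle (m₁ M) t a∈t , onCycle (m₂ M) t b∈t , onCycle (m₃ M) t c∈t , onCycle e t e∈t)
  where
  onCycle : ∀ a t → OnCycle (indexOf a) t → EdgeOf a (lookup hamCycles t)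
  onCycle a t = indexOf-EdgeOf a (lookup hamCycles t) ∘ OnCycle-sound (indexOf a) t

lemma4p2 : (M : Matching3) (e f : Edge) →
    ¬ InMatching e M → ¬ InMatching f M →
    ¬ Extendable M e → ¬ Extendable M f →
    SameEdge e f
lemma4p2 M e f e∉M f∉M e-stuck f-stuck =
  indexOf-injective e f
    (atMostOneBlocked
      (indexOf a) (indexOf b) (indexOf-Disjoint a b (d₁₂ M))
      (indexOf c) (indexOf-Disjoint a c (d₁₃ M)) (indexOf-Disjoint b c (d₂₃ M))
      _ (nonExtendable⇒Blocked M e e∉M e-stuck)
      _ (nonExtendable⇒Blocked M f f∉M f-stuck))
  where
  a = m₁ M
  b = m₂ M
  c = m₃ M
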